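{- If $A$ is $1$-generic and $B \le_T A$ is generically computable, then $B$ is coarsely computable.
   Context: For $X \subseteq \omega$ and $n \ge 1$ let $\rho_n(X) = |X \cap \{0,\dots,n-1\}|/n$, $\underline{\rho}(X) = \liminf_n \rho_n(X)$, $\rho(X)=\lim_n\rho_n(X)$ when it exists. $B$ is generically computable if there is a partial computable function $\varphi$ with $\varphi(n) = B(n)$ for all $n \in \operatorname{dom}\varphi$ and $\rho(\operatorname{dom}\varphi) = 1$. $B$ is coarsely computable if there is a computable set $C$ with $\rho(\{n : B(n)=C(n)\})=1$. A set $A$ is $1$-generic if for every c.e. set $S$ of finite binary strings, either some initial segment of $A$ lies in $S$, or some initial segment of $A$ has no extension in $S$. -}

module Defs where

open import Data.Nat using (ℕ; zero; suc; _+_; _*_; _≤_; _<_)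
open import Data.Bool using (Bool; true; false; if_then_else_)
open import Data.Fin using (Fin)
open import Data.Vec using (Vec; []; _∷_; lookup)
open import Data.List using (List; []; _∷_; _++_; length; map; upTo)
open import Data.List.Relation.Unary.All using (All)
open import Data.List.Relation.Unary.Unique.Propositional using (Unique)
open import Data.Product using (Σ; ∃; _×_; _,_)
open import Data.Sum using (_⊎_)
open import Relation.Binary.PropositionalEquality using (_≡_)
open import Relation.Nullary using (¬_)

SetN : Set
SetN = ℕ → Bool

bit : Bool → ℕ
bit true  = 1
bit false = 0

-- Oracle partial recursive functions (Kleene's μ-recursive functions
-- with an extra oracle-query basic function).

data PR : ℕ → Set where
  zeroF : ∀ {k} → PR k
  succF : PR 1
  proj  : ∀ {k} → Fin k → PR k
  comp  : ∀ {k m} → PR m → Vec (PR k) m → PR k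
  prec  : ∀ {k} → PR k → PR (suc (suc k)) → PR (suc k)
  mu    : ∀ {k} → PR (suc k) → PR k
  orc   : PR 1

mutual
  data Eval (O : SetN) : ∀ {k} → PR k → Vec ℕ k → ℕ → Set where
    ev-zero : ∀ {k} {xs : Vec ℕ k} → Eval O zeroF xs 0
    ev-succ : ∀ {x} → Eval O succF (x ∷ []) (suc x)
    ev-proj : ∀ {k} {i : Fin k} {xs} → Eval O (proj i) xs (lookup xs i)
    ev-comp : ∀ {k m} {f : PR m} {gs : Vec (PR k) m} {xs ys y} →
              EvalVec O gs xs ys → Eval O f ys y → Eval O (comp f gs) xs y
    ev-prec0 : ∀ {k} {g : PR k} {h} {xs y} →
               Eval O g xs y → Eval O (prec g h) (0 ∷ xs) y
    ev-precS : ∀ {k} {g : PR k} {h} {n xs r y} →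
               Eval O (prec g h) (n ∷ xs) r → Eval O h (n ∷ r ∷ xs) y →
               Eval O (prec g h) (suc n ∷ xs) y
    ev-mu   : ∀ {k} {f : PR (suc k)} {xs y} →
              Eval O f (y ∷ xs) 0 →
              (∀ z → z < y → ∃ λ v → Eval O f (z ∷ xs) (suc v)) →
              Eval O (mu f) xs y
    ev-orc  : ∀ {x} → Eval O orc (x ∷ []) (bit (O x))

  data EvalVec (O : SetN) {k : ℕ} : ∀ {m} → Vec (PR k) m → Vec ℕ k → Vec ℕ m → Set where
    evv-nil  : ∀ {xs} → EvalVec O [] xs []
    evv-cons : ∀ {m} {g} {gs : Vec (PR k) m} {xs y ys} →
               Eval O g xs y → EvalVec O gs xs ys → EvalVec O (g ∷ gs) xs (y ∷ ys)

-- The empty oracle: unrelativised computation.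
∅ : SetN
∅ _ = false

Conv : SetN → PR 1 → ℕ → ℕ → Set
Conv O e n y = Eval O e (n ∷ []) y

Dom : PR 1 → ℕ → Set
Dom e n = ∃ λ y → Conv ∅ e n y

Computable : SetN → Set
Computable C = Σ (PR 1) λ e → ∀ n → Conv ∅ e n (bit (C n))

TuringBelow : SetN → SetN → Set
TuringBelow B A = Σ (PR 1) λ e → ∀ n → Conv A e n (bit (B n))

AtLeastBelow : (ℕ → Set) → ℕ → ℕ → Set
AtLeastBelow X n m = Σ (List ℕ) λ l →
  Unique l × All (λ x → x < n × X x) l × length l ≡ m

-- ρ(X) = 1: for every k there is N such that ρ_n(X) ≥ k/(k+1) for all n ≥ N
-- (since ρ_n ≤ 1 this is liminf = lim = 1).
DensityOne : (ℕ → Set) → Set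
DensityOne X = ∀ k → ∃ λ N → ∀ n → N ≤ n →
  ∃ λ m → AtLeastBelow X n m × k * n ≤ suc k * m

GenericallyComputable : SetN → Set
GenericallyComputable B = Σ (PR 1) λ e →
  (∀ n y → Conv ∅ e n y → y ≡ bit (B n)) × DensityOne (Dom e)

CoarselyComputable : SetN → Set
CoarselyComputable B = Σ SetN λ C → Computable C × DensityOne (λ n → B n ≡ C n)

-- Bijective coding of finite binary strings by natural numbers.
code : List Bool → ℕ
code []      = 0
code (b ∷ s) = suc (bit b + 2 * code s)

restrict : SetN → ℕ → List Bool
restrict A n = map A (upTo n)

-- W_e viewed as a c.e. set of strings: σ ∈ W_e iff φ_e(code σ)↓.
InCE : PR 1 → List Bool → Set
InCE e σ = Dom e (code σ)

OneGeneric : SetN → Set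
OneGeneric A = ∀ (e : PR 1) →
  (∃ λ n → InCE e (restrict A n)) ⊎
  (∃ λ n → ∀ (τ : List Bool) → ¬ InCE e (restrict A n ++ τ))

-- Let Φ^A = B and let φ be a generic algorithm for B.  The strings σ for which Φ^σ(n) and φ(n)
-- converge to different values for some n form a c.e. set W.  No prefix of A lies in W, since
-- Φ^A(n) = B(n) = φ(n) whenever φ(n) converges; so by 1-genericity some prefix σ₀ of A has no
-- extension in W.  Let C(n) be the value of Φ^(σ₀ρ)(n) for the first string ρ (in the order of
-- codes) for which this computation converges within code ρ steps.  Such a ρ exists because A
-- extends σ₀, so C is computable; and C(n) = φ(n) = B(n) whenever φ(n) converges, since otherwise
-- an extension of σ₀ρ would lie in W.  Hence C agrees with B on dom φ, which has density 1.
--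
-- The searches are made effective by compiling every program into a primitive recursive one that
-- runs it for a bounded number of search steps against a finite oracle string; this clocked
-- evaluation is sound, monotone and complete with respect to Eval.

module Submission where

open import Defs
open import Data.Bool using (Bool; true; false)
open import Data.Empty using (⊥-elim)
open import Data.Fin using (Fin; _↑ʳ_) renaming (zero to fzero; suc to fsuc)
open import Data.List using (List; []; _∷_; _++_; length; applyUpTo; replicate)
open import Data.List.Properties using (map-upTo; length-applyUpTo; length-++; length-replicate; ++-assoc)
open import Data.List.Relation.Unary.All using () renaming (map to mapᴬ)
open import Data.Nat using (ℕ; zero; suc; _+_; _*_; _∸_; _≤_; _<_; z≤n; s≤s; pred; _⊔_; _<?_)
open import Data.Nat.Properties
open import Data.Product using (∃; _×_; _,_; proj₁; proj₂; map₂)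
open import Data.Sum using (_⊎_; inj₁; inj₂; [_,_]′)
open import Data.Vec using (Vec; []; _∷_; lookup; tabulate) renaming (map to mapᵛ; _++_ to _++ᵛ_)
open import Data.Vec.Properties using (tabulate-cong; lookup-++ʳ; tabulate∘lookup; ∷-injective)
open import Function using (id)
open import Relation.Binary.Definitions using (tri<; tri≈; tri>)
open import Relation.Binary.PropositionalEquality
open import Relation.Nullary using (¬_; yes; no)

-- Primitive recursive programs

data Prim : ℕ → Set where
  zeroᵖ : ∀ {k} → Prim k
  sucᵖ  : Prim 1
  projᵖ : ∀ {k} → Fin k → Prim k
  compᵖ : ∀ {k m} → Prim m → Vec (Prim k) m → Prim k
  recᵖ  : ∀ {k} → Prim k → Prim (suc (suc k)) → Prim (suc k)

mutual
  ⟦_⟧ : ∀ {k} → Prim k → Vec ℕ k → ℕ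
  ⟦ zeroᵖ ⟧     xs       = 0
  ⟦ sucᵖ ⟧      (x ∷ []) = suc x
  ⟦ projᵖ i ⟧   xs       = lookup xs i
  ⟦ compᵖ f gs ⟧ xs      = ⟦ f ⟧ (⟦ gs ⟧* xs)
  ⟦ recᵖ g h ⟧  (n ∷ xs) = primRec g h n xs

  ⟦_⟧* : ∀ {k m} → Vec (Prim k) m → Vec ℕ k → Vec ℕ m
  ⟦ [] ⟧*     xs = []
  ⟦ g ∷ gs ⟧* xs = ⟦ g ⟧ xs ∷ ⟦ gs ⟧* xs

  primRec : ∀ {k} → Prim k → Prim (suc (suc k)) → ℕ → Vec ℕ k → ℕ
  primRec g h zero    xs = ⟦ g ⟧ xs
  primRec g h (suc n) xs = ⟦ h ⟧ (n ∷ primRec g h n xs ∷ xs)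

mutual
  toPR : ∀ {k} → Prim k → PR k
  toPR zeroᵖ        = zeroF
  toPR sucᵖ         = succF
  toPR (projᵖ i)    = proj i
  toPR (compᵖ f gs) = comp (toPR f) (toPR* gs)
  toPR (recᵖ g h)   = prec (toPR g) (toPR h)

  toPR* : ∀ {k m} → Vec (Prim k) m → Vec (PR k) m
  toPR* []       = []
  toPR* (g ∷ gs) = toPR g ∷ toPR* gs

mutual
  Eval-toPR : ∀ {O k} (p : Prim k) xs → Eval O (toPR p) xs (⟦ p ⟧ xs)
  Eval-toPR zeroᵖ        xs       = ev-zero
  Eval-toPR sucᵖ         (x ∷ []) = ev-succ
  Eval-toPR (projᵖ i)    xs       = ev-proj
  Eval-toPR (compᵖ f gs) xs       = ev-comp (EvalVec-toPR* gs xs) (Eval-toPR f _)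
  Eval-toPR (recᵖ g h)   (n ∷ xs) = Eval-toPR-rec g h n xs

  EvalVec-toPR* : ∀ {O k m} (gs : Vec (Prim k) m) xs → EvalVec O (toPR* gs) xs (⟦ gs ⟧* xs)
  EvalVec-toPR* []       xs = evv-nil
  EvalVec-toPR* (g ∷ gs) xs = evv-cons (Eval-toPR g xs) (EvalVec-toPR* gs xs)

  Eval-toPR-rec : ∀ {O k} (g : Prim k) h n xs →
                  Eval O (prec (toPR g) (toPR h)) (n ∷ xs) (primRec g h n xs)
  Eval-toPR-rec g h zero    xs = ev-prec0 (Eval-toPR g xs)
  Eval-toPR-rec g h (suc n) xs = ev-precS (Eval-toPR-rec g h n xs) (Eval-toPR h _)

mutual
  Eval-functional : ∀ {O k} {f : PR k} {xs y y′} → Eval O f xs y → Eval O f xs y′ → y ≡ y′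
  Eval-functional ev-zero ev-zero = refl
  Eval-functional ev-succ ev-succ = refl
  Eval-functional ev-proj ev-proj = refl
  Eval-functional (ev-comp ds d) (ev-comp ds′ d′) with EvalVec-functional ds ds′
  ... | refl = Eval-functional d d′
  Eval-functional (ev-prec0 d) (ev-prec0 d′) = Eval-functional d d′
  Eval-functional (ev-precS d e) (ev-precS d′ e′) with Eval-functional d d′
  ... | refl = Eval-functional e e′
  Eval-functional (ev-mu {y = y} d below) (ev-mu {y = y′} d′ below′) with <-cmp y y′
  ... | tri< y<y′ _ _ with Eval-functional d (proj₂ (below′ y y<y′))
  ...   | ()
  Eval-functional (ev-mu d below) (ev-mu d′ below′) | tri≈ _ y≡y′ _ = y≡y′
  Eval-functional (ev-mu {y = y} d below) (ev-mu {y = y′} d′ below′) | tri> _ _ y′<y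
    with Eval-functional d′ (proj₂ (below y′ y′<y))
  ...   | ()
  Eval-functional ev-orc ev-orc = refl

  EvalVec-functional : ∀ {O k m} {gs : Vec (PR k) m} {xs ys ys′} →
                       EvalVec O gs xs ys → EvalVec O gs xs ys′ → ys ≡ ys′
  EvalVec-functional evv-nil         evv-nil         = refl
  EvalVec-functional (evv-cons d ds) (evv-cons e es) =
    cong₂ _∷_ (Eval-functional d e) (EvalVec-functional ds es)


⟦tabulate⟧* : ∀ {k j} (f : Fin k → Prim j) xs → ⟦ tabulate f ⟧* xs ≡ tabulate (λ i → ⟦ f i ⟧ xs)
⟦tabulate⟧* {zero}  f xs = refl
⟦tabulate⟧* {suc k} f xs = cong (⟦ f fzero ⟧ xs ∷_) (⟦tabulate⟧* (λ i → f (fsuc i)) xs)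

dropᵖ : ∀ j {k} → Vec (Prim (j + k)) k
dropᵖ j = tabulate (λ i → projᵖ (j ↑ʳ i))

⟦dropᵖ⟧ : ∀ {j k} (ys : Vec ℕ j) (xs : Vec ℕ k) → ⟦ dropᵖ j ⟧* (ys ++ᵛ xs) ≡ xs
⟦dropᵖ⟧ ys xs = begin
  ⟦ dropᵖ _ ⟧* (ys ++ᵛ xs)                  ≡⟨ ⟦tabulate⟧* _ (ys ++ᵛ xs) ⟩
  tabulate (λ i → lookup (ys ++ᵛ xs) (_ ↑ʳ i)) ≡⟨ tabulate-cong (lookup-++ʳ ys xs) ⟩
  tabulate (lookup xs)                       ≡⟨ tabulate∘lookup xs ⟩
  xs                                         ∎
  where open ≡-Reasoning

idᵖ : ∀ {k} → Vec (Prim k) k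
idᵖ = dropᵖ 0

⟦idᵖ⟧ : ∀ {k} (xs : Vec ℕ k) → ⟦ idᵖ ⟧* xs ≡ xs
⟦idᵖ⟧ = ⟦dropᵖ⟧ []

π₀ : ∀ {k} → Prim (suc k)
π₀ = projᵖ fzero

π₁ : ∀ {k} → Prim (suc (suc k))
π₁ = projᵖ (fsuc fzero)

π₂ : ∀ {k} → Prim (suc (suc (suc k)))
π₂ = projᵖ (fsuc (fsuc fzero))

π₃ : ∀ {k} → Prim (suc (suc (suc (suc k))))
π₃ = projᵖ (fsuc (fsuc (fsuc fzero)))

constᵖ : ∀ {k} → ℕ → Prim k
constᵖ zero    = zeroᵖ
constᵖ (suc n) = compᵖ sucᵖ (constᵖ n ∷ [])

⟦constᵖ⟧ : ∀ {k} n (xs : Vec ℕ k) → ⟦ constᵖ n ⟧ xs ≡ n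
⟦constᵖ⟧ zero    xs = refl
⟦constᵖ⟧ (suc n) xs = cong suc (⟦constᵖ⟧ n xs)

incᵖ : ∀ {k} → Prim k → Prim k
incᵖ c = compᵖ sucᵖ (c ∷ [])

decᵖ : ∀ {k} → Prim k → Prim k
decᵖ c = compᵖ (recᵖ zeroᵖ π₀) (c ∷ [])

⟦decᵖ⟧ : ∀ {k} (c : Prim k) xs → ⟦ decᵖ c ⟧ xs ≡ pred (⟦ c ⟧ xs)
⟦decᵖ⟧ c xs with ⟦ c ⟧ xs
... | zero  = refl
... | suc n = refl

if0 : ℕ → ℕ → ℕ → ℕ
if0 zero    a b = a
if0 (suc _) a b = b

if0-≢0 : ∀ {a} b c → a ≢ 0 → if0 a b c ≡ c
if0-≢0 {zero}  b c a≢0 = ⊥-elim (a≢0 refl)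
if0-≢0 {suc a} b c _   = refl

-- Primitive recursion on the condition, with a step that ignores the recursive value.
if0ᵖ : ∀ {k} → Prim k → Prim k → Prim k → Prim k
if0ᵖ c a b = compᵖ (recᵖ a (compᵖ b (dropᵖ 2))) (c ∷ idᵖ)

⟦if0ᵖ⟧ : ∀ {k} (c a b : Prim k) xs → ⟦ if0ᵖ c a b ⟧ xs ≡ if0 (⟦ c ⟧ xs) (⟦ a ⟧ xs) (⟦ b ⟧ xs)
⟦if0ᵖ⟧ c a b xs rewrite ⟦idᵖ⟧ xs = cases (⟦ c ⟧ xs)
  where
  cases : ∀ n → primRec a (compᵖ b (dropᵖ 2)) n xs ≡ if0 n (⟦ a ⟧ xs) (⟦ b ⟧ xs)
  cases zero    = refl
  cases (suc n) = cong ⟦ b ⟧ (⟦dropᵖ⟧ (n ∷ _ ∷ []) xs)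

parity : ℕ → ℕ
parity zero    = 0
parity (suc n) = if0 (parity n) 1 0

half : ℕ → ℕ
half zero    = 0
half (suc n) = if0 (parity n) (half n) (suc (half n))

parityᵖ : Prim 1
parityᵖ = recᵖ zeroᵖ (if0ᵖ π₁ (constᵖ 1) zeroᵖ)

⟦parityᵖ⟧ : ∀ n → ⟦ parityᵖ ⟧ (n ∷ []) ≡ parity n
⟦parityᵖ⟧ zero    = refl
⟦parityᵖ⟧ (suc n) = trans (⟦if0ᵖ⟧ π₁ (constᵖ 1) zeroᵖ (n ∷ ⟦ parityᵖ ⟧ (n ∷ []) ∷ []))
  (cong (λ p → if0 p 1 0) (⟦parityᵖ⟧ n))

halfᵖ : Prim 1
halfᵖ = recᵖ zeroᵖ (if0ᵖ (compᵖ parityᵖ (π₀ ∷ [])) π₁ (incᵖ π₁))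

⟦halfᵖ⟧ : ∀ n → ⟦ halfᵖ ⟧ (n ∷ []) ≡ half n
⟦halfᵖ⟧ zero    = refl
⟦halfᵖ⟧ (suc n) = trans (⟦if0ᵖ⟧ (compᵖ parityᵖ (π₀ ∷ [])) π₁ (incᵖ π₁) (n ∷ ⟦ halfᵖ ⟧ (n ∷ []) ∷ []))
  (cong₂ (λ p h → if0 p h (suc h)) (⟦parityᵖ⟧ n) (⟦halfᵖ⟧ n))

doubleᵖ : Prim 1
doubleᵖ = recᵖ zeroᵖ (incᵖ (incᵖ π₁))

⟦doubleᵖ⟧ : ∀ n → ⟦ doubleᵖ ⟧ (n ∷ []) ≡ 2 * n
⟦doubleᵖ⟧ zero    = refl
⟦doubleᵖ⟧ (suc n) = trans (cong (2 +_) (⟦doubleᵖ⟧ n)) (sym (*-suc 2 n))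

monusᵖ : Prim 2
monusᵖ = recᵖ π₀ (decᵖ π₁)

⟦monusᵖ⟧ : ∀ y x → ⟦ monusᵖ ⟧ (y ∷ x ∷ []) ≡ x ∸ y
⟦monusᵖ⟧ zero    x = refl
⟦monusᵖ⟧ (suc y) x = begin
  ⟦ decᵖ π₁ ⟧ (y ∷ r ∷ x ∷ []) ≡⟨ ⟦decᵖ⟧ π₁ (y ∷ r ∷ x ∷ []) ⟩
  pred r                        ≡⟨ cong pred (⟦monusᵖ⟧ y x) ⟩
  pred (x ∸ y)                  ≡⟨ pred[m∸n]≡m∸[1+n] x y ⟩
  x ∸ suc y                     ∎
  where
  open ≡-Reasoning
  r = ⟦ monusᵖ ⟧ (y ∷ x ∷ [])

differ : ℕ → ℕ → ℕ
differ x y = if0 (x ∸ y) (y ∸ x) 1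

differ-self : ∀ x → differ x x ≡ 0
differ-self x rewrite n∸n≡0 x = refl

differ≡0⇒≡ : ∀ x y → differ x y ≡ 0 → x ≡ y
differ≡0⇒≡ x y e with x ∸ y in x∸y≡0
... | zero = ≤-antisym (m∸n≡0⇒m≤n x∸y≡0) (m∸n≡0⇒m≤n e)

_∸ᵖ_ : ∀ {k} → Prim k → Prim k → Prim k
a ∸ᵖ b = compᵖ monusᵖ (b ∷ a ∷ [])

differᵖ : ∀ {k} → Prim k → Prim k → Prim k
differᵖ a b = if0ᵖ (a ∸ᵖ b) (b ∸ᵖ a) (constᵖ 1)

⟦differᵖ⟧ : ∀ {k} (a b : Prim k) xs → ⟦ differᵖ a b ⟧ xs ≡ differ (⟦ a ⟧ xs) (⟦ b ⟧ xs)
⟦differᵖ⟧ a b xs = trans (⟦if0ᵖ⟧ (a ∸ᵖ b) (b ∸ᵖ a) (constᵖ 1) xs)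
  (cong₂ (λ u v → if0 u v 1) (⟦monusᵖ⟧ (⟦ b ⟧ xs) (⟦ a ⟧ xs)) (⟦monusᵖ⟧ (⟦ a ⟧ xs) (⟦ b ⟧ xs)))

anyBelow : (ℕ → ℕ) → ℕ → ℕ
anyBelow d zero    = 0
anyBelow d (suc i) = if0 (d i) (anyBelow d i) 1

anyBelow-cong : ∀ {d d′} → (∀ i → d i ≡ d′ i) → ∀ c → anyBelow d c ≡ anyBelow d′ c
anyBelow-cong d≗d′ zero    = refl
anyBelow-cong d≗d′ (suc c) = cong₂ (λ a r → if0 a r 1) (d≗d′ c) (anyBelow-cong d≗d′ c)

anyBelow-witness : ∀ d c → anyBelow d c ≢ 0 → ∃ λ i → i < c × d i ≢ 0
anyBelow-witness d zero    any≢0 = ⊥-elim (any≢0 refl)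
anyBelow-witness d (suc c) any≢0 with d c in dc
... | zero  = let (i , i<c , di≢0) = anyBelow-witness d c any≢0 in i , m≤n⇒m≤1+n i<c , di≢0
... | suc _ = c , ≤-refl , λ dc≡0 → 1+n≢0 (trans (sym dc) dc≡0)

anyBelow-intro : ∀ d c i → i < c → d i ≢ 0 → anyBelow d c ≢ 0
anyBelow-intro d (suc c) i i<1+c di≢0 any≡0 with d c in dc
... | suc _ = 1+n≢0 any≡0
... | zero with m≤n⇒m<n∨m≡n (≤-pred i<1+c)
...   | inj₁ i<c  = anyBelow-intro d c i i<c di≢0 any≡0
...   | inj₂ refl = di≢0 dc

anyBelowᵖ : Prim 2 → Prim 1
anyBelowᵖ D = compᵖ (recᵖ zeroᵖ (if0ᵖ (compᵖ D (π₀ ∷ π₂ ∷ [])) π₁ (constᵖ 1))) (π₀ ∷ π₀ ∷ [])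

⟦anyBelowᵖ⟧ : ∀ D s → ⟦ anyBelowᵖ D ⟧ (s ∷ []) ≡ anyBelow (λ i → ⟦ D ⟧ (i ∷ s ∷ [])) s
⟦anyBelowᵖ⟧ D s = go s
  where
  go : ∀ c → ⟦ recᵖ zeroᵖ (if0ᵖ (compᵖ D (π₀ ∷ π₂ ∷ [])) π₁ (constᵖ 1)) ⟧ (c ∷ s ∷ []) ≡
           anyBelow (λ i → ⟦ D ⟧ (i ∷ s ∷ [])) c
  go zero    = refl
  go (suc c) = trans (⟦if0ᵖ⟧ (compᵖ D (π₀ ∷ π₂ ∷ [])) π₁ (constᵖ 1) (c ∷ _ ∷ s ∷ []))
    (cong (λ r → if0 (⟦ D ⟧ (c ∷ s ∷ [])) r 1) (go c))

-- Binary strings and their codes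

parity≡bit : ∀ n → ∃ λ b → parity n ≡ bit b
parity≡bit zero = false , refl
parity≡bit (suc n) with parity≡bit n
... | false , p≡0 rewrite p≡0 = true , refl
... | true  , p≡1 rewrite p≡1 = false , refl

parity-2+ : ∀ n → parity (2 + n) ≡ parity n
parity-2+ n with parity≡bit n
... | false , p≡0 rewrite p≡0 = refl
... | true  , p≡1 rewrite p≡1 = refl

half-2+ : ∀ n → half (2 + n) ≡ suc (half n)
half-2+ n with parity≡bit n
... | false , p≡0 rewrite p≡0 = refl
... | true  , p≡1 rewrite p≡1 = refl

+2*-suc : ∀ a c → a + 2 * suc c ≡ 2 + (a + 2 * c)
+2*-suc a c = trans (cong (a +_) (*-suc 2 c)) (trans (+-suc a _) (cong suc (+-suc a _)))

parity-bit+2* : ∀ b c → parity (bit b + 2 * c) ≡ bit b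
parity-bit+2* false zero    = refl
parity-bit+2* true  zero    = refl
parity-bit+2* b     (suc c) rewrite +2*-suc (bit b) c =
  trans (parity-2+ (bit b + 2 * c)) (parity-bit+2* b c)

half-bit+2* : ∀ b c → half (bit b + 2 * c) ≡ c
half-bit+2* false zero    = refl
half-bit+2* true  zero    = refl
half-bit+2* b     (suc c) rewrite +2*-suc (bit b) c =
  trans (half-2+ (bit b + 2 * c)) (cong suc (half-bit+2* b c))

parity+2*half : ∀ n → parity n + 2 * half n ≡ n
parity+2*half zero = refl
parity+2*half (suc n) with parity≡bit n | parity+2*half n
... | false , p≡0 | eq rewrite p≡0 = cong suc eq
... | true  , p≡1 | eq rewrite p≡1 | *-suc 2 (half n) = cong suc eq

half≤ : ∀ n → half n ≤ n
half≤ n = begin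
  half n                    ≤⟨ m≤m+n (half n) (half n + 0) ⟩
  2 * half n                ≤⟨ m≤n+m _ (parity n) ⟩
  parity n + 2 * half n     ≡⟨ parity+2*half n ⟩
  n                         ∎
  where open ≤-Reasoning

code-surjective : ∀ n → ∃ λ σ → code σ ≡ n
code-surjective n = go n n ≤-refl
  where
  go : ∀ fuel n → n ≤ fuel → ∃ λ σ → code σ ≡ n
  go fuel       zero    _         = [] , refl
  go (suc fuel) (suc n) (s≤s n≤f) with go fuel (half n) (≤-trans (half≤ n) n≤f) | parity≡bit n
  ... | σ , σ↦half | b , p≡b = b ∷ σ , cong suc (begin
    bit b + 2 * code σ     ≡⟨ cong₂ (λ p c → p + 2 * c) p≡b (sym σ↦half) ⟨
    parity n + 2 * half n  ≡⟨ parity+2*half n ⟩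
    n                      ∎)
    where open ≡-Reasoning

length≤code : ∀ σ → length σ ≤ code σ
length≤code []      = z≤n
length≤code (b ∷ σ) = s≤s (begin
  length σ            ≤⟨ length≤code σ ⟩
  code σ              ≤⟨ m≤m+n (code σ) (code σ + 0) ⟩
  2 * code σ          ≤⟨ m≤n+m _ (bit b) ⟩
  bit b + 2 * code σ  ∎)
  where open ≤-Reasoning

length≤code-++ : ∀ σ ρ → length ρ ≤ code (σ ++ ρ)
length≤code-++ σ ρ = begin
  length ρ              ≤⟨ m≤n+m (length ρ) (length σ) ⟩
  length σ + length ρ   ≡⟨ length-++ σ ⟨
  length (σ ++ ρ)       ≤⟨ length≤code (σ ++ ρ) ⟩
  code (σ ++ ρ)         ∎
  where open ≤-Reasoning

-- code (b ∷ σ) ↦ code σ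
tailᶜ : ℕ → ℕ
tailᶜ s = if0 s 0 (half (pred s))

dropᶜ : ℕ → ℕ → ℕ
dropᶜ zero    s = s
dropᶜ (suc x) s = tailᶜ (dropᶜ x s)

-- code [] ↦ 0 and code (b ∷ σ) ↦ suc (bit b)
headᶜ : ℕ → ℕ
headᶜ s = if0 s 0 (suc (parity (pred s)))

query : ℕ → ℕ → ℕ
query s x = headᶜ (dropᶜ x s)

lookupBit : List Bool → ℕ → ℕ
lookupBit []      x       = 0
lookupBit (b ∷ σ) zero    = suc (bit b)
lookupBit (b ∷ σ) (suc x) = lookupBit σ x

dropᶜ-tailᶜ : ∀ x s → dropᶜ x (tailᶜ s) ≡ tailᶜ (dropᶜ x s)
dropᶜ-tailᶜ zero    s = refl
dropᶜ-tailᶜ (suc x) s = cong tailᶜ (dropᶜ-tailᶜ x s)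

dropᶜ-0 : ∀ x → dropᶜ x 0 ≡ 0
dropᶜ-0 zero    = refl
dropᶜ-0 (suc x) = cong tailᶜ (dropᶜ-0 x)

query-code : ∀ σ x → query (code σ) x ≡ lookupBit σ x
query-code []      x       = cong headᶜ (dropᶜ-0 x)
query-code (b ∷ σ) zero    = cong suc (parity-bit+2* b (code σ))
query-code (b ∷ σ) (suc x) = begin
  headᶜ (tailᶜ (dropᶜ x (code (b ∷ σ))))
    ≡⟨ cong headᶜ (dropᶜ-tailᶜ x (code (b ∷ σ))) ⟨
  headᶜ (dropᶜ x (half (bit b + 2 * code σ)))
    ≡⟨ cong (λ s → headᶜ (dropᶜ x s)) (half-bit+2* b (code σ)) ⟩
  query (code σ) x
    ≡⟨ query-code σ x ⟩
  lookupBit σ x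
    ∎
  where open ≡-Reasoning

lookupBit-applyUpTo-< : ∀ (f : ℕ → Bool) {m x} → x < m → lookupBit (applyUpTo f m) x ≡ suc (bit (f x))
lookupBit-applyUpTo-< f {suc m} {zero}  _         = refl
lookupBit-applyUpTo-< f {suc m} {suc x} (s≤s x<m) = lookupBit-applyUpTo-< (λ i → f (suc i)) x<m

lookupBit-applyUpTo-≥ : ∀ (f : ℕ → Bool) {m x} → m ≤ x → lookupBit (applyUpTo f m) x ≡ 0
lookupBit-applyUpTo-≥ f {zero}          _         = refl
lookupBit-applyUpTo-≥ f {suc m} {suc x} (s≤s m≤x) = lookupBit-applyUpTo-≥ (λ i → f (suc i)) m≤x

prefixCode : SetN → ℕ → ℕ
prefixCode X m = code (restrict X m)

query-prefixCode : ∀ X m x → query (prefixCode X m) x ≡ lookupBit (applyUpTo X m) x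
query-prefixCode X m x = trans (query-code (restrict X m) x) (cong (λ σ → lookupBit σ x) (map-upTo X m))

query-prefixCode-< : ∀ X {m x} → x < m → query (prefixCode X m) x ≡ suc (bit (X x))
query-prefixCode-< X {m} {x} x<m = trans (query-prefixCode X m x) (lookupBit-applyUpTo-< X x<m)

query-prefixCode-≡suc : ∀ X m x {b} → query (prefixCode X m) x ≡ suc b → b ≡ bit (X x) × x < m
query-prefixCode-≡suc X m x q≡1+b with x <? m
... | yes x<m = suc-injective (trans (sym q≡1+b) (query-prefixCode-< X x<m)) , x<m
... | no  x≮m = ⊥-elim (1+n≢0 (trans (sym q≡1+b)
                  (trans (query-prefixCode X m x) (lookupBit-applyUpTo-≥ X (≮⇒≥ x≮m)))))

Consistent : SetN → ℕ → Set
Consistent X s = ∀ x {b} → query s x ≡ suc b → b ≡ bit (X x)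

_⊑_ : ℕ → ℕ → Set
s ⊑ s′ = ∀ x {b} → query s x ≡ suc b → query s′ x ≡ suc b

prefixCode-consistent : ∀ X m → Consistent X (prefixCode X m)
prefixCode-consistent X m x q≡1+b = proj₁ (query-prefixCode-≡suc X m x q≡1+b)

prefixCode-⊑ : ∀ X {m m′} → m ≤ m′ → prefixCode X m ⊑ prefixCode X m′
prefixCode-⊑ X {m} m≤m′ x q≡1+b with query-prefixCode-≡suc X m x q≡1+b
... | refl , x<m = query-prefixCode-< X (<-≤-trans x<m m≤m′)

lookupBit-++ : ∀ σ ρ x {b} → lookupBit σ x ≡ suc b → lookupBit (σ ++ ρ) x ≡ suc b
lookupBit-++ (c ∷ σ) ρ zero    eq = eq
lookupBit-++ (c ∷ σ) ρ (suc x) eq = lookupBit-++ σ ρ x eq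

code-⊑-++ : ∀ σ ρ → code σ ⊑ code (σ ++ ρ)
code-⊑-++ σ ρ x q≡1+b =
  trans (query-code (σ ++ ρ) x) (lookupBit-++ σ ρ x (trans (sym (query-code σ x)) q≡1+b))

restrict-+ : ∀ X a k → restrict X (a + k) ≡ restrict X a ++ restrict (λ i → X (a + i)) k
restrict-+ X a k rewrite map-upTo X (a + k) | map-upTo X a | map-upTo (λ i → X (a + i)) k = go X a
  where
  go : ∀ (f : ℕ → Bool) a → applyUpTo f (a + k) ≡ applyUpTo f a ++ applyUpTo (λ i → f (a + i)) k
  go f zero    = refl
  go f (suc a) = cong (f 0 ∷_) (go (λ i → f (suc i)) a)

length-restrict : ∀ X n → length (restrict X n) ≡ n
length-restrict X n = trans (cong length (map-upTo X n)) (length-applyUpTo X n)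

dropᶜᵖ : Prim 2
dropᶜᵖ = recᵖ π₀ (if0ᵖ π₁ zeroᵖ (compᵖ halfᵖ (decᵖ π₁ ∷ [])))

⟦dropᶜᵖ⟧ : ∀ x s → ⟦ dropᶜᵖ ⟧ (x ∷ s ∷ []) ≡ dropᶜ x s
⟦dropᶜᵖ⟧ zero    s = refl
⟦dropᶜᵖ⟧ (suc x) s = begin
  ⟦ if0ᵖ π₁ zeroᵖ (compᵖ halfᵖ (decᵖ π₁ ∷ [])) ⟧ (x ∷ r ∷ s ∷ [])
    ≡⟨ ⟦if0ᵖ⟧ π₁ zeroᵖ (compᵖ halfᵖ (decᵖ π₁ ∷ [])) (x ∷ r ∷ s ∷ []) ⟩
  if0 r 0 (⟦ halfᵖ ⟧ (⟦ decᵖ π₁ ⟧ (x ∷ r ∷ s ∷ []) ∷ []))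
    ≡⟨ cong (λ p → if0 r 0 (⟦ halfᵖ ⟧ (p ∷ []))) (⟦decᵖ⟧ π₁ (x ∷ r ∷ s ∷ [])) ⟩
  if0 r 0 (⟦ halfᵖ ⟧ (pred r ∷ []))
    ≡⟨ cong (if0 r 0) (⟦halfᵖ⟧ (pred r)) ⟩
  tailᶜ r
    ≡⟨ cong tailᶜ (⟦dropᶜᵖ⟧ x s) ⟩
  tailᶜ (dropᶜ x s)
    ∎
  where
  open ≡-Reasoning
  r = ⟦ dropᶜᵖ ⟧ (x ∷ s ∷ [])

queryᵖ : Prim 2
queryᵖ = if0ᵖ dropᶜᵖ zeroᵖ (incᵖ (compᵖ parityᵖ (decᵖ dropᶜᵖ ∷ [])))

⟦queryᵖ⟧ : ∀ x s → ⟦ queryᵖ ⟧ (x ∷ s ∷ []) ≡ query s x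
⟦queryᵖ⟧ x s
  rewrite ⟦if0ᵖ⟧ dropᶜᵖ zeroᵖ (incᵖ (compᵖ parityᵖ (decᵖ dropᶜᵖ ∷ []))) (x ∷ s ∷ [])
        | ⟦decᵖ⟧ dropᶜᵖ (x ∷ s ∷ [])
        | ⟦dropᶜᵖ⟧ x s
        | ⟦parityᵖ⟧ (pred (dropᶜ x s)) = refl

appendCodeᵖ : List Bool → Prim 1
appendCodeᵖ []          = π₀
appendCodeᵖ (false ∷ σ) = incᵖ (compᵖ doubleᵖ (appendCodeᵖ σ ∷ []))
appendCodeᵖ (true ∷ σ)  = incᵖ (incᵖ (compᵖ doubleᵖ (appendCodeᵖ σ ∷ [])))

⟦appendCodeᵖ⟧ : ∀ σ ρ → ⟦ appendCodeᵖ σ ⟧ (code ρ ∷ []) ≡ code (σ ++ ρ)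
⟦appendCodeᵖ⟧ []          ρ = refl
⟦appendCodeᵖ⟧ (false ∷ σ) ρ =
  cong suc (trans (⟦doubleᵖ⟧ (⟦ appendCodeᵖ σ ⟧ (code ρ ∷ []))) (cong (2 *_) (⟦appendCodeᵖ⟧ σ ρ)))
⟦appendCodeᵖ⟧ (true ∷ σ)  ρ =
  cong (2 +_) (trans (⟦doubleᵖ⟧ (⟦ appendCodeᵖ σ ⟧ (code ρ ∷ []))) (cong (2 *_) (⟦appendCodeᵖ⟧ σ ρ)))

emptyPrefixCodeᵖ : Prim 1
emptyPrefixCodeᵖ = recᵖ zeroᵖ (incᵖ (compᵖ doubleᵖ (π₁ ∷ [])))

⟦emptyPrefixCodeᵖ⟧ : ∀ m → ⟦ emptyPrefixCodeᵖ ⟧ (m ∷ []) ≡ prefixCode ∅ m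
⟦emptyPrefixCodeᵖ⟧ m = trans (go m) (cong code (sym (map-upTo ∅ m)))
  where
  go : ∀ m → ⟦ emptyPrefixCodeᵖ ⟧ (m ∷ []) ≡ code (applyUpTo ∅ m)
  go zero    = refl
  go (suc m) = cong suc (trans (⟦doubleᵖ⟧ (⟦ emptyPrefixCodeᵖ ⟧ (m ∷ []))) (cong (2 *_) (go m)))

-- Clocked evaluation relative to an oracle string

guard : ∀ {m} → Vec ℕ m → ℕ → ℕ
guard []       r = r
guard (c ∷ cs) r = if0 c 0 (guard cs r)

-- States of a search: 0 = a candidate gave no result, 1 = searching, suc (suc y) = found y;
-- so pred of the final state is the shifted result.
searchStep : ℕ → ℕ → ℕ → ℕ
searchStep z st v = if0 st 0 (if0 (pred st) (if0 v 0 (if0 (pred v) (2 + z) 1)) st)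

search : (ℕ → ℕ) → ℕ → ℕ
search F zero    = 1
search F (suc z) = searchStep z (search F z) (F z)

-- run t s f xs evaluates f on xs, answering oracle queries from the string coded by s and
-- bounding every unbounded search by t + 1 candidates.  Results are shifted: 0 means that
-- no result was obtained, suc y that the output is y.
mutual
  run : ∀ {k} → ℕ → ℕ → PR k → Vec ℕ k → ℕ
  run t s zeroF       xs       = 1
  run t s succF       (x ∷ []) = 2 + x
  run t s (proj i)    xs       = suc (lookup xs i)
  run t s (comp f gs) xs       = guard (run* t s gs xs) (run t s f (mapᵛ pred (run* t s gs xs)))
  run t s (prec g h)  (n ∷ xs) = runRec t s g h n xs
  run t s (mu f)      xs       = pred (search (λ w → run t s f (w ∷ xs)) (suc t))
  run t s orc         (x ∷ []) = query s x

  run* : ∀ {k m} → ℕ → ℕ → Vec (PR k) m → Vec ℕ k → Vec ℕ m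
  run* t s []       xs = []
  run* t s (g ∷ gs) xs = run t s g xs ∷ run* t s gs xs

  runRec : ∀ {k} → ℕ → ℕ → PR k → PR (suc (suc k)) → ℕ → Vec ℕ k → ℕ
  runRec t s g h zero    xs = run t s g xs
  runRec t s g h (suc n) xs =
    if0 (runRec t s g h n xs) 0 (run t s h (n ∷ pred (runRec t s g h n xs) ∷ xs))

guardᵖ : ∀ {k m} → Vec (Prim k) m → Prim k → Prim k
guardᵖ []       r = r
guardᵖ (c ∷ cs) r = if0ᵖ c zeroᵖ (guardᵖ cs r)

⟦guardᵖ⟧ : ∀ {k m} (cs : Vec (Prim k) m) r xs → ⟦ guardᵖ cs r ⟧ xs ≡ guard (⟦ cs ⟧* xs) (⟦ r ⟧ xs)
⟦guardᵖ⟧ []       r xs = refl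
⟦guardᵖ⟧ (c ∷ cs) r xs =
  trans (⟦if0ᵖ⟧ c zeroᵖ (guardᵖ cs r) xs) (cong (if0 (⟦ c ⟧ xs) 0) (⟦guardᵖ⟧ cs r xs))

⟦map-decᵖ⟧ : ∀ {k m} (cs : Vec (Prim k) m) xs → ⟦ mapᵛ decᵖ cs ⟧* xs ≡ mapᵛ pred (⟦ cs ⟧* xs)
⟦map-decᵖ⟧ []       xs = refl
⟦map-decᵖ⟧ (c ∷ cs) xs = cong₂ _∷_ (⟦decᵖ⟧ c xs) (⟦map-decᵖ⟧ cs xs)

searchStepᵖ : ∀ {k} → Prim k → Prim k → Prim k → Prim k
searchStepᵖ z st v =
  if0ᵖ st zeroᵖ (if0ᵖ (decᵖ st) (if0ᵖ v zeroᵖ (if0ᵖ (decᵖ v) (incᵖ (incᵖ z)) (constᵖ 1))) st)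

⟦searchStepᵖ⟧ : ∀ {k} (z st v : Prim k) xs →
                ⟦ searchStepᵖ z st v ⟧ xs ≡ searchStep (⟦ z ⟧ xs) (⟦ st ⟧ xs) (⟦ v ⟧ xs)
⟦searchStepᵖ⟧ z st v xs
  rewrite ⟦if0ᵖ⟧ st zeroᵖ (if0ᵖ (decᵖ st) (if0ᵖ v zeroᵖ (if0ᵖ (decᵖ v) (incᵖ (incᵖ z)) (constᵖ 1))) st) xs
        | ⟦if0ᵖ⟧ (decᵖ st) (if0ᵖ v zeroᵖ (if0ᵖ (decᵖ v) (incᵖ (incᵖ z)) (constᵖ 1))) st xs
        | ⟦if0ᵖ⟧ v zeroᵖ (if0ᵖ (decᵖ v) (incᵖ (incᵖ z)) (constᵖ 1)) xs
        | ⟦if0ᵖ⟧ (decᵖ v) (incᵖ (incᵖ z)) (constᵖ 1) xs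
        | ⟦decᵖ⟧ st xs | ⟦decᵖ⟧ v xs = refl

-- The arguments of compile f are t ∷ s ∷ xs.
mutual
  compile : ∀ {k} → PR k → Prim (suc (suc k))
  compile zeroF       = constᵖ 1
  compile succF       = incᵖ (incᵖ π₂)
  compile (proj i)    = incᵖ (projᵖ (fsuc (fsuc i)))
  compile (comp f gs) = guardᵖ (compile* gs) (compᵖ (compile f) (π₀ ∷ π₁ ∷ mapᵛ decᵖ (compile* gs)))
  compile (prec g h)  = compᵖ (recᵖ (compile g) (compileRecStep h)) (π₂ ∷ π₀ ∷ π₁ ∷ dropᵖ 3)
  compile (mu f)      = decᵖ (compᵖ (recᵖ (constᵖ 1) (compileSearchStep f)) (incᵖ π₀ ∷ π₀ ∷ π₁ ∷ dropᵖ 2))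
  compile orc         = compᵖ queryᵖ (π₂ ∷ π₁ ∷ [])

  compile* : ∀ {k m} → Vec (PR k) m → Vec (Prim (suc (suc k))) m
  compile* []       = []
  compile* (g ∷ gs) = compile g ∷ compile* gs

  -- arguments n ∷ r ∷ t ∷ s ∷ xs
  compileRecStep : ∀ {k} → PR (suc (suc k)) → Prim (suc (suc (suc (suc k))))
  compileRecStep h = if0ᵖ π₁ zeroᵖ (compᵖ (compile h) (π₂ ∷ π₃ ∷ π₀ ∷ decᵖ π₁ ∷ dropᵖ 4))

  -- arguments z ∷ state ∷ t ∷ s ∷ xs
  compileSearchStep : ∀ {k} → PR (suc k) → Prim (suc (suc (suc (suc k))))
  compileSearchStep f = searchStepᵖ π₀ π₁ (compᵖ (compile f) (π₂ ∷ π₃ ∷ π₀ ∷ dropᵖ 4))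

mutual
  ⟦compile⟧ : ∀ {k} (f : PR k) t s xs → ⟦ compile f ⟧ (t ∷ s ∷ xs) ≡ run t s f xs
  ⟦compile⟧ zeroF       t s xs       = refl
  ⟦compile⟧ succF       t s (x ∷ []) = refl
  ⟦compile⟧ (proj i)    t s xs       = refl
  ⟦compile⟧ (comp f gs) t s xs
    rewrite ⟦guardᵖ⟧ (compile* gs) (compᵖ (compile f) (π₀ ∷ π₁ ∷ mapᵛ decᵖ (compile* gs))) (t ∷ s ∷ xs)
          | ⟦map-decᵖ⟧ (compile* gs) (t ∷ s ∷ xs)
          | ⟦compile*⟧ gs t s xs
          | ⟦compile⟧ f t s (mapᵛ pred (run* t s gs xs)) = refl
  ⟦compile⟧ (prec g h)  t s (n ∷ xs)
    rewrite ⟦dropᵖ⟧ (t ∷ s ∷ n ∷ []) xs = ⟦compile⟧-rec g h t s n xs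
  ⟦compile⟧ (mu f)      t s xs
    rewrite ⟦decᵖ⟧ (compᵖ (recᵖ (constᵖ 1) (compileSearchStep f)) (incᵖ π₀ ∷ π₀ ∷ π₁ ∷ dropᵖ 2)) (t ∷ s ∷ xs)
          | ⟦dropᵖ⟧ (t ∷ s ∷ []) xs
          | ⟦compile⟧-search f t s xs (suc t) = refl
  ⟦compile⟧ orc         t s (x ∷ []) = ⟦queryᵖ⟧ x s

  ⟦compile*⟧ : ∀ {k m} (gs : Vec (PR k) m) t s xs → ⟦ compile* gs ⟧* (t ∷ s ∷ xs) ≡ run* t s gs xs
  ⟦compile*⟧ []       t s xs = refl
  ⟦compile*⟧ (g ∷ gs) t s xs = cong₂ _∷_ (⟦compile⟧ g t s xs) (⟦compile*⟧ gs t s xs)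

  ⟦compileRecStep⟧ : ∀ {k} (h : PR (suc (suc k))) n r t s xs →
                     ⟦ compileRecStep h ⟧ (n ∷ r ∷ t ∷ s ∷ xs) ≡ if0 r 0 (run t s h (n ∷ pred r ∷ xs))
  ⟦compileRecStep⟧ h n r t s xs
    rewrite ⟦if0ᵖ⟧ π₁ zeroᵖ (compᵖ (compile h) (π₂ ∷ π₃ ∷ π₀ ∷ decᵖ π₁ ∷ dropᵖ 4)) (n ∷ r ∷ t ∷ s ∷ xs)
          | ⟦dropᵖ⟧ (n ∷ r ∷ t ∷ s ∷ []) xs
          | ⟦decᵖ⟧ {4} π₁ (n ∷ r ∷ t ∷ s ∷ [])
          | ⟦compile⟧ h t s (n ∷ pred r ∷ xs) = refl

  ⟦compile⟧-rec : ∀ {k} (g : PR k) h t s n xs →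
                  primRec (compile g) (compileRecStep h) n (t ∷ s ∷ xs) ≡ runRec t s g h n xs
  ⟦compile⟧-rec g h t s zero    xs = ⟦compile⟧ g t s xs
  ⟦compile⟧-rec g h t s (suc n) xs =
    trans (⟦compileRecStep⟧ h n (primRec (compile g) (compileRecStep h) n (t ∷ s ∷ xs)) t s xs)
          (cong (λ r → if0 r 0 (run t s h (n ∷ pred r ∷ xs))) (⟦compile⟧-rec g h t s n xs))

  ⟦compileSearchStep⟧ : ∀ {k} (f : PR (suc k)) z st t s xs →
                        ⟦ compileSearchStep f ⟧ (z ∷ st ∷ t ∷ s ∷ xs) ≡ searchStep z st (run t s f (z ∷ xs))
  ⟦compileSearchStep⟧ f z st t s xs
    rewrite ⟦searchStepᵖ⟧ π₀ π₁ (compᵖ (compile f) (π₂ ∷ π₃ ∷ π₀ ∷ dropᵖ 4)) (z ∷ st ∷ t ∷ s ∷ xs)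
          | ⟦dropᵖ⟧ (z ∷ st ∷ t ∷ s ∷ []) xs
          | ⟦compile⟧ f t s (z ∷ xs) = refl

  ⟦compile⟧-search : ∀ {k} (f : PR (suc k)) t s xs z →
                     primRec (constᵖ 1) (compileSearchStep f) z (t ∷ s ∷ xs) ≡ search (λ w → run t s f (w ∷ xs)) z
  ⟦compile⟧-search f t s xs zero    = refl
  ⟦compile⟧-search f t s xs (suc z) =
    trans (⟦compileSearchStep⟧ f z (primRec (constᵖ 1) (compileSearchStep f) z (t ∷ s ∷ xs)) t s xs)
          (cong (λ st → searchStep z st (run t s f (z ∷ xs))) (⟦compile⟧-search f t s xs z))

-- Soundness, monotonicity and completeness of clocked evaluation

-- F w ≡ suc (suc v): candidate w yields the nonzero output v.
RejectedBelow : (ℕ → ℕ) → ℕ → Set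
RejectedBelow F y = ∀ w → w < y → ∃ λ v → F w ≡ suc (suc v)

search≡1⇒rejected : ∀ F z → search F z ≡ 1 → RejectedBelow F z
search≡1⇒rejected F (suc z) st≡1 w w<1+z with search F z in st | F z in Fz
... | zero          | _             = ⊥-elim (0≢1+n st≡1)
... | suc zero      | zero          = ⊥-elim (0≢1+n st≡1)
... | suc zero      | suc zero      = ⊥-elim (1+n≢0 (suc-injective st≡1))
... | suc (suc _)   | _             = ⊥-elim (0≢1+n (suc-injective (sym st≡1)))
... | suc zero      | suc (suc v) with m≤n⇒m<n∨m≡n (≤-pred w<1+z)
...   | inj₁ w<z  = search≡1⇒rejected F z st w w<z
...   | inj₂ refl = v , Fz

search≡found⇒ : ∀ F z y → search F z ≡ suc (suc y) → F y ≡ 1 × RejectedBelow F y × y < z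
search≡found⇒ F (suc z) y found with search F z in st | F z in Fz
... | zero          | _           = ⊥-elim (0≢1+n found)
... | suc zero      | zero        = ⊥-elim (0≢1+n found)
... | suc zero      | suc (suc _) = ⊥-elim (0≢1+n (suc-injective found))
... | suc zero      | suc zero with found
...   | refl = Fz , search≡1⇒rejected F z st , ≤-refl
search≡found⇒ F (suc z) y found | suc (suc _) | _ =
  let (Fy≡1 , rejected , y<z) = search≡found⇒ F z y (trans st found) in Fy≡1 , rejected , m≤n⇒m≤1+n y<z

search-pending : ∀ F y → RejectedBelow F y → ∀ z → z ≤ y → search F z ≡ 1
search-pending F y rejected zero    _   = refl
search-pending F y rejected (suc z) z<y with rejected z z<y
... | v , Fz rewrite search-pending F y rejected z (<⇒≤ z<y) | Fz = refl

search-finds : ∀ F y → F y ≡ 1 → RejectedBelow F y → ∀ z → y < z → search F z ≡ suc (suc y)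
search-finds F y Fy≡1 rejected (suc z) (s≤s y≤z) with m≤n⇒m<n∨m≡n y≤z
... | inj₂ refl rewrite search-pending F y rejected y ≤-refl | Fy≡1 = refl
... | inj₁ y<z  rewrite search-finds F y Fy≡1 rejected z y<z = refl

guard≡suc⇒ : ∀ {m} (cs : Vec ℕ m) r {y} → guard cs r ≡ suc y → ∃ λ ys → cs ≡ mapᵛ suc ys × r ≡ suc y
guard≡suc⇒ []            r r≡1+y = [] , refl , r≡1+y
guard≡suc⇒ (suc c ∷ cs) r g≡1+y =
  let (ys , cs≡ , r≡1+y) = guard≡suc⇒ cs r g≡1+y in c ∷ ys , cong (suc c ∷_) cs≡ , r≡1+y

guard-suc : ∀ {m} (ys : Vec ℕ m) r → guard (mapᵛ suc ys) r ≡ r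
guard-suc []       r = refl
guard-suc (y ∷ ys) r = guard-suc ys r

pred∘suc : ∀ {m} (ys : Vec ℕ m) → mapᵛ pred (mapᵛ suc ys) ≡ ys
pred∘suc []       = refl
pred∘suc (y ∷ ys) = cong (y ∷_) (pred∘suc ys)

run-comp≡suc⇒ : ∀ {k m} t s (f : PR m) (gs : Vec (PR k) m) xs {y} → run t s (comp f gs) xs ≡ suc y →
                ∃ λ ys → run* t s gs xs ≡ mapᵛ suc ys × run t s f ys ≡ suc y
run-comp≡suc⇒ t s f gs xs r≡1+y with guard≡suc⇒ (run* t s gs xs) _ r≡1+y
... | ys , gs≡ , f≡1+y rewrite gs≡ | pred∘suc ys = ys , refl , f≡1+y

run-mu≡suc⇒ : ∀ {k} t s (f : PR (suc k)) xs {y} → run t s (mu f) xs ≡ suc y →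
              run t s f (y ∷ xs) ≡ 1 × RejectedBelow (λ w → run t s f (w ∷ xs)) y × y < suc t
run-mu≡suc⇒ t s f xs {y} r≡1+y = search≡found⇒ _ (suc t) y (pred≡suc r≡1+y)
  where
  pred≡suc : ∀ {n} → pred n ≡ suc y → n ≡ suc (suc y)
  pred≡suc {suc n} refl = refl

mutual
  run-sound : ∀ {X k} t s (f : PR k) xs {y} → Consistent X s → run t s f xs ≡ suc y → Eval X f xs y
  run-sound t s zeroF       xs       _ refl = ev-zero
  run-sound t s succF       (x ∷ []) _ refl = ev-succ
  run-sound t s (proj i)    xs       _ refl = ev-proj
  run-sound t s (comp f gs) xs       c r≡1+y with run-comp≡suc⇒ t s f gs xs r≡1+y
  ... | ys , gs≡ , f≡ = ev-comp (run*-sound t s gs xs c gs≡) (run-sound t s f ys c f≡)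
  run-sound t s (prec g h)  (n ∷ xs) c r≡1+y = runRec-sound t s g h n xs c r≡1+y
  run-sound t s (mu f)      xs       c r≡1+y with run-mu≡suc⇒ t s f xs r≡1+y
  ... | f≡1 , rejected , _ = ev-mu (run-sound t s f _ c f≡1)
    (λ w w<y → let (v , f≡) = rejected w w<y in v , run-sound t s f _ c f≡)
  run-sound t s orc         (x ∷ []) c r≡1+y with c x r≡1+y
  ... | refl = ev-orc

  run*-sound : ∀ {X k m} t s (gs : Vec (PR k) m) xs {ys} → Consistent X s →
               run* t s gs xs ≡ mapᵛ suc ys → EvalVec X gs xs ys
  run*-sound t s []       xs {[]}     c _   = evv-nil
  run*-sound t s (g ∷ gs) xs {y ∷ ys} c eqs =
    let (g≡ , gs≡) = ∷-injective eqs in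
    evv-cons (run-sound t s g xs c g≡) (run*-sound t s gs xs c gs≡)

  runRec-sound : ∀ {X k} t s (g : PR k) h n xs {y} → Consistent X s →
                 runRec t s g h n xs ≡ suc y → Eval X (prec g h) (n ∷ xs) y
  runRec-sound t s g h zero    xs c r≡1+y = ev-prec0 (run-sound t s g xs c r≡1+y)
  runRec-sound t s g h (suc n) xs c r≡1+y with runRec t s g h n xs in r
  ... | suc _ = ev-precS (runRec-sound t s g h n xs c r) (run-sound t s h _ c r≡1+y)

mutual
  run-mono : ∀ {k} {t t′ s s′} (f : PR k) xs {y} → s ⊑ s′ → t ≤ t′ →
             run t s f xs ≡ suc y → run t′ s′ f xs ≡ suc y
  run-mono zeroF       xs       _ _ r≡1+y = r≡1+y
  run-mono succF       (x ∷ []) _ _ r≡1+y = r≡1+y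
  run-mono (proj i)    xs       _ _ r≡1+y = r≡1+y
  run-mono {t = t} {t′} {s} {s′} (comp f gs) xs s⊑ t≤ r≡1+y with run-comp≡suc⇒ t s f gs xs r≡1+y
  ... | ys , gs≡ , f≡
    rewrite run*-mono gs xs s⊑ t≤ gs≡ | pred∘suc ys | guard-suc ys (run t′ s′ f ys) = run-mono f ys s⊑ t≤ f≡
  run-mono (prec g h)  (n ∷ xs) s⊑ t≤ r≡1+y = runRec-mono g h n xs s⊑ t≤ r≡1+y
  run-mono {t = t} {t′} {s} {s′} (mu f) xs {y} s⊑ t≤ r≡1+y with run-mu≡suc⇒ t s f xs r≡1+y
  ... | f≡1 , rejected , y<1+t
    rewrite search-finds (λ w → run t′ s′ f (w ∷ xs)) y (run-mono f _ s⊑ t≤ f≡1)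
              (λ w w<y → let (v , f≡) = rejected w w<y in v , run-mono f _ s⊑ t≤ f≡)
              (suc t′) (<-≤-trans y<1+t (s≤s t≤)) = refl
  run-mono orc         (x ∷ []) s⊑ _ r≡1+y = s⊑ x r≡1+y

  run*-mono : ∀ {k m} {t t′ s s′} (gs : Vec (PR k) m) xs {ys} → s ⊑ s′ → t ≤ t′ →
              run* t s gs xs ≡ mapᵛ suc ys → run* t′ s′ gs xs ≡ mapᵛ suc ys
  run*-mono []       xs {[]}     _  _  _   = refl
  run*-mono (g ∷ gs) xs {y ∷ ys} s⊑ t≤ eqs =
    let (g≡ , gs≡) = ∷-injective eqs in
    cong₂ _∷_ (run-mono g xs s⊑ t≤ g≡) (run*-mono gs xs s⊑ t≤ gs≡)

  runRec-mono : ∀ {k} {t t′ s s′} (g : PR k) h n xs {y} → s ⊑ s′ → t ≤ t′ →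
                runRec t s g h n xs ≡ suc y → runRec t′ s′ g h n xs ≡ suc y
  runRec-mono g h zero    xs s⊑ t≤ r≡1+y = run-mono g xs s⊑ t≤ r≡1+y
  runRec-mono {t = t} {s = s} g h (suc n) xs s⊑ t≤ r≡1+y with runRec t s g h n xs in r
  ... | suc _ rewrite runRec-mono g h n xs s⊑ t≤ r = run-mono h _ s⊑ t≤ r≡1+y

ClockedEval : SetN → ∀ {k} → PR k → Vec ℕ k → ℕ → Set
ClockedEval X f xs y = ∃ λ t → ∃ λ m → run t (prefixCode X m) f xs ≡ suc y

run-prefix-mono : ∀ X {k} (f : PR k) xs {y t t′ m m′} → t ≤ t′ → m ≤ m′ →
                  run t (prefixCode X m) f xs ≡ suc y → run t′ (prefixCode X m′) f xs ≡ suc y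
run-prefix-mono X f xs t≤ m≤ = run-mono f xs (prefixCode-⊑ X m≤) t≤

rejected-complete : ∀ X {k} (f : PR (suc k)) xs y →
                    (∀ w → w < y → ∃ λ v → ClockedEval X f (w ∷ xs) (suc v)) →
                    ∃ λ t → ∃ λ m → RejectedBelow (λ w → run t (prefixCode X m) f (w ∷ xs)) y
rejected-complete X f xs zero    _        = 0 , 0 , λ w ()
rejected-complete X f xs (suc y) rejected
  with rejected-complete X f xs y (λ w w<y → rejected w (m≤n⇒m≤1+n w<y)) | rejected y ≤-refl
... | t , m , below | v , t′ , m′ , r≡ = t ⊔ t′ , m ⊔ m′ , go
  where
  go : RejectedBelow (λ w → run (t ⊔ t′) (prefixCode X (m ⊔ m′)) f (w ∷ xs)) (suc y)
  go w w<1+y with m≤n⇒m<n∨m≡n (≤-pred w<1+y)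
  ... | inj₁ w<y  = let (u , r≡′) = below w w<y in
                    u , run-prefix-mono X f _ (m≤m⊔n t t′) (m≤m⊔n m m′) r≡′
  ... | inj₂ refl = v , run-prefix-mono X f _ (m≤n⊔m t t′) (m≤n⊔m m m′) r≡

mutual
  run-complete : ∀ {X k} {f : PR k} {xs y} → Eval X f xs y → ClockedEval X f xs y
  run-complete ev-zero = 0 , 0 , refl
  run-complete ev-succ = 0 , 0 , refl
  run-complete ev-proj = 0 , 0 , refl
  run-complete {X} (ev-comp {f = f} {gs} {xs} {ys} ds d) with run*-complete ds | run-complete d
  ... | t₁ , m₁ , gs≡ | t₂ , m₂ , f≡ = t₁ ⊔ t₂ , m₁ ⊔ m₂ , goal
    where
    goal : run (t₁ ⊔ t₂) (prefixCode X (m₁ ⊔ m₂)) (comp f gs) xs ≡ suc _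
    goal rewrite run*-mono gs xs (prefixCode-⊑ X (m≤m⊔n m₁ m₂)) (m≤m⊔n t₁ t₂) gs≡
               | pred∘suc ys | guard-suc ys (run (t₁ ⊔ t₂) (prefixCode X (m₁ ⊔ m₂)) f ys)
      = run-prefix-mono X f ys (m≤n⊔m t₁ t₂) (m≤n⊔m m₁ m₂) f≡
  run-complete (ev-prec0 d) = run-complete d
  run-complete {X} (ev-precS {g = g} {h} {n} {xs} d e) with run-complete d | run-complete e
  ... | t₁ , m₁ , d≡ | t₂ , m₂ , e≡ = t₁ ⊔ t₂ , m₁ ⊔ m₂ , goal
    where
    goal : run (t₁ ⊔ t₂) (prefixCode X (m₁ ⊔ m₂)) (prec g h) (suc n ∷ xs) ≡ suc _
    goal rewrite run-prefix-mono X (prec g h) (n ∷ xs) (m≤m⊔n t₁ t₂) (m≤m⊔n m₁ m₂) d≡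
      = run-prefix-mono X h _ (m≤n⊔m t₁ t₂) (m≤n⊔m m₁ m₂) e≡
  run-complete {X} (ev-mu {f = f} {xs} {y} d rejected)
    with run-complete d | rejected-complete X f xs y (λ w w<y → run-complete-nonzero (rejected w w<y))
  ... | t₀ , m₀ , d≡ | t , m , below = T , M , goal
    where
    T = (t ⊔ t₀) ⊔ y
    M = m ⊔ m₀
    t≤T : t ≤ T
    t≤T = ≤-trans (m≤m⊔n t t₀) (m≤m⊔n _ y)
    t₀≤T : t₀ ≤ T
    t₀≤T = ≤-trans (m≤n⊔m t t₀) (m≤m⊔n _ y)
    goal : run T (prefixCode X M) (mu f) xs ≡ suc y
    goal rewrite search-finds (λ w → run T (prefixCode X M) f (w ∷ xs)) y
                   (run-prefix-mono X f _ t₀≤T (m≤n⊔m m m₀) d≡)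
                   (λ w w<y → let (v , r≡) = below w w<y in
                              v , run-prefix-mono X f _ t≤T (m≤m⊔n m m₀) r≡)
                   (suc T) (s≤s (m≤n⊔m _ y)) = refl
  run-complete {X} (ev-orc {x = x}) = 0 , suc x , query-prefixCode-< X ≤-refl

  run-complete-nonzero : ∀ {X k} {f : PR (suc k)} {w xs} →
                         (∃ λ v → Eval X f (w ∷ xs) (suc v)) → ∃ λ v → ClockedEval X f (w ∷ xs) (suc v)
  run-complete-nonzero (v , d) = v , run-complete d

  run*-complete : ∀ {X k m} {gs : Vec (PR k) m} {xs ys} → EvalVec X gs xs ys →
                  ∃ λ t → ∃ λ m → run* t (prefixCode X m) gs xs ≡ mapᵛ suc ys
  run*-complete evv-nil = 0 , 0 , refl
  run*-complete {X} (evv-cons {g = g} {gs} {xs} d ds) with run-complete d | run*-complete ds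
  ... | t₁ , m₁ , g≡ | t₂ , m₂ , gs≡ = t₁ ⊔ t₂ , m₁ ⊔ m₂ ,
    cong₂ _∷_ (run-prefix-mono X g xs (m≤m⊔n t₁ t₂) (m≤m⊔n m₁ m₂) g≡)
              (run*-mono gs xs (prefixCode-⊑ X (m≤n⊔m m₁ m₂)) (m≤n⊔m t₁ t₂) gs≡)

-- Minimisation

LeastNonzero : (ℕ → ℕ) → ℕ → Set
LeastNonzero d j = d j ≢ 0 × (∀ w → w < j → d w ≡ 0)

leastNonzero : ∀ d j → d j ≢ 0 → ∃ (LeastNonzero d)
leastNonzero d j dj≢0 = [ (λ below → ⊥-elim (dj≢0 (below j ≤-refl))) , id ]′ (zeroBelow-or-least (suc j))
  where
  zeroBelow-or-least : ∀ c → (∀ w → w < c → d w ≡ 0) ⊎ ∃ (LeastNonzero d)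
  zeroBelow-or-least zero = inj₁ (λ w ())
  zeroBelow-or-least (suc c) with zeroBelow-or-least c
  ... | inj₂ least = inj₂ least
  ... | inj₁ below with d c ≟ 0
  ...   | no  dc≢0 = inj₂ (c , dc≢0 , below)
  ...   | yes dc≡0 = inj₁ λ w w<1+c → [ below w , (λ { refl → dc≡0 }) ]′ (m≤n⇒m<n∨m≡n (≤-pred w<1+c))

-- μ j. ⟦ p ⟧ (j ∷ n ∷ []) ≢ 0
minimise : Prim 2 → PR 1
minimise p = mu (toPR (if0ᵖ p (constᵖ 1) zeroᵖ))

Eval-minimise : ∀ {O} p n j → LeastNonzero (λ w → ⟦ p ⟧ (w ∷ n ∷ [])) j → Eval O (minimise p) (n ∷ []) j
Eval-minimise p n j (pj≢0 , below) = ev-mu (found j pj≢0) λ w w<j → 0 , rejected w (below w w<j)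
  where
  test : Prim 2
  test = if0ᵖ p (constᵖ 1) zeroᵖ
  ⟦test⟧ : ∀ w → ⟦ test ⟧ (w ∷ n ∷ []) ≡ if0 (⟦ p ⟧ (w ∷ n ∷ [])) 1 0
  ⟦test⟧ w = ⟦if0ᵖ⟧ p (constᵖ 1) zeroᵖ (w ∷ n ∷ [])
  found : ∀ w → ⟦ p ⟧ (w ∷ n ∷ []) ≢ 0 → Eval _ (toPR test) (w ∷ n ∷ []) 0
  found w pw≢0 = subst (Eval _ (toPR test) _) (trans (⟦test⟧ w) (if0-≢0 1 0 pw≢0)) (Eval-toPR test _)
  rejected : ∀ w → ⟦ p ⟧ (w ∷ n ∷ []) ≡ 0 → Eval _ (toPR test) (w ∷ n ∷ []) 1
  rejected w pw≡0 =
    subst (Eval _ (toPR test) _) (trans (⟦test⟧ w) (cong (λ a → if0 a 1 0) pw≡0)) (Eval-toPR test _)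

Eval-minimise⇒nonzero : ∀ {O} p n j → Eval O (minimise p) (n ∷ []) j → ⟦ p ⟧ (j ∷ n ∷ []) ≢ 0
Eval-minimise⇒nonzero p n j (ev-mu found _) pj≡0 =
  0≢1+n (trans (Eval-functional found (Eval-toPR (if0ᵖ p (constᵖ 1) zeroᵖ) _))
               (trans (⟦if0ᵖ⟧ p (constᵖ 1) zeroᵖ (j ∷ n ∷ [])) (cong (λ a → if0 a 1 0) pj≡0)))

-- The reduction

DensityOne-mono : ∀ {X Y : ℕ → Set} → (∀ n → X n → Y n) → DensityOne X → DensityOne Y
DensityOne-mono X⊆Y dense k =
  let (N , bound) = dense k in
  N , λ n N≤n → let (m , (l , unique , elems , len) , ineq) = bound n N≤n in
                m , (l , unique , mapᴬ (map₂ (X⊆Y _)) elems , len) , ineq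

nonzero? : ℕ → Bool
nonzero? zero    = false
nonzero? (suc _) = true

bit∘nonzero? : ∀ a → bit (nonzero? a) ≡ if0 a 0 1
bit∘nonzero? zero    = refl
bit∘nonzero? (suc _) = refl

nonzero?∘bit : ∀ b → nonzero? (bit b) ≡ b
nonzero?∘bit false = refl
nonzero?∘bit true  = refl

module Reduction (A B : SetN) (Φ φ : PR 1)
         (Φ^A≡B : ∀ n → Conv A Φ n (bit (B n)))
         (φ-correct : ∀ n y → Conv ∅ φ n y → y ≡ bit (B n)) where

  -- Stage s: s is the clock of both computations, and Φ consults the string coded by s.
  Φ-run : ℕ → ℕ → ℕ
  Φ-run s n = run s s Φ (n ∷ [])

  φ-run : ℕ → ℕ → ℕ
  φ-run s n = run s (prefixCode ∅ s) φ (n ∷ [])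

  disagree : ℕ → ℕ → ℕ
  disagree s n = if0 (Φ-run s n) 0 (if0 (φ-run s n) 0 (differ (Φ-run s n) (φ-run s n)))

  Φ-runᵖ φ-runᵖ disagreeᵖ : Prim 2
  Φ-runᵖ    = compᵖ (compile Φ) (π₁ ∷ π₁ ∷ π₀ ∷ [])
  φ-runᵖ    = compᵖ (compile φ) (π₁ ∷ compᵖ emptyPrefixCodeᵖ (π₁ ∷ []) ∷ π₀ ∷ [])
  disagreeᵖ = if0ᵖ Φ-runᵖ zeroᵖ (if0ᵖ φ-runᵖ zeroᵖ (differᵖ Φ-runᵖ φ-runᵖ))

  ⟦disagreeᵖ⟧ : ∀ s n → ⟦ disagreeᵖ ⟧ (n ∷ s ∷ []) ≡ disagree s n
  ⟦disagreeᵖ⟧ s n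
    rewrite ⟦if0ᵖ⟧ Φ-runᵖ zeroᵖ (if0ᵖ φ-runᵖ zeroᵖ (differᵖ Φ-runᵖ φ-runᵖ)) (n ∷ s ∷ [])
          | ⟦if0ᵖ⟧ φ-runᵖ zeroᵖ (differᵖ Φ-runᵖ φ-runᵖ) (n ∷ s ∷ [])
          | ⟦differᵖ⟧ Φ-runᵖ φ-runᵖ (n ∷ s ∷ [])
          | ⟦compile⟧ Φ s s (n ∷ [])
          | ⟦emptyPrefixCodeᵖ⟧ s
          | ⟦compile⟧ φ s (prefixCode ∅ s) (n ∷ []) = refl

  disagree≢0⇒ : ∀ s n → disagree s n ≢ 0 →
                ∃ λ y → ∃ λ z → Φ-run s n ≡ suc y × φ-run s n ≡ suc z × y ≢ z
  disagree≢0⇒ s n d≢0 with Φ-run s n | φ-run s n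
  ... | zero  | _     = ⊥-elim (d≢0 refl)
  ... | suc y | zero  = ⊥-elim (d≢0 refl)
  ... | suc y | suc z = y , z , refl , refl , λ { refl → d≢0 (differ-self (suc y)) }

  disagree-intro : ∀ s n {y z} → Φ-run s n ≡ suc y → φ-run s n ≡ suc z → y ≢ z → disagree s n ≢ 0
  disagree-intro s n Φ≡ φ≡ y≢z d≡0 rewrite Φ≡ | φ≡ =
    y≢z (suc-injective (differ≡0⇒≡ _ _ d≡0))

  W : PR 1
  W = minimise (compᵖ (anyBelowᵖ disagreeᵖ) (π₁ ∷ []))

  ⟦W-test⟧ : ∀ j s → ⟦ compᵖ (anyBelowᵖ disagreeᵖ) (π₁ ∷ []) ⟧ (j ∷ s ∷ []) ≡ anyBelow (disagree s) s
  ⟦W-test⟧ j s = trans (⟦anyBelowᵖ⟧ disagreeᵖ s) (anyBelow-cong (⟦disagreeᵖ⟧ s) s)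

  W-dom⇒ : ∀ s → Dom W s → ∃ λ n → n < s × disagree s n ≢ 0
  W-dom⇒ s (j , W↓) = anyBelow-witness (disagree s) s
    (subst (_≢ 0) (⟦W-test⟧ j s) (Eval-minimise⇒nonzero _ s j W↓))

  W-dom⇐ : ∀ s n → n < s → disagree s n ≢ 0 → Dom W s
  W-dom⇐ s n n<s d≢0 = 0 , Eval-minimise _ s 0 (test≢0 , λ w ())
    where
    test≢0 : ⟦ compᵖ (anyBelowᵖ disagreeᵖ) (π₁ ∷ []) ⟧ (0 ∷ s ∷ []) ≢ 0
    test≢0 = subst (_≢ 0) (sym (⟦W-test⟧ 0 s)) (anyBelow-intro (disagree s) s n n<s d≢0)

  prefix∉W : ∀ m → ¬ InCE W (restrict A m)
  prefix∉W m A↾m∈W with W-dom⇒ (prefixCode A m) A↾m∈W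
  ... | n , _ , d≢0 with disagree≢0⇒ (prefixCode A m) n d≢0
  ...   | y , z , Φ≡ , φ≡ , y≢z = y≢z (begin
    y           ≡⟨ Eval-functional (run-sound _ _ Φ (n ∷ []) (prefixCode-consistent A m) Φ≡) (Φ^A≡B n) ⟩
    bit (B n)   ≡⟨ φ-correct n z (run-sound _ _ φ (n ∷ []) (prefixCode-consistent ∅ _) φ≡) ⟨
    z           ∎)
    where open ≡-Reasoning

  module Extending (m₀ : ℕ) (noExtension : ∀ ρ → ¬ InCE W (restrict A m₀ ++ ρ)) where

    σ₀ : List Bool
    σ₀ = restrict A m₀

    attemptᵖ : Prim 2
    attemptᵖ = compᵖ (compile Φ) (π₀ ∷ compᵖ (appendCodeᵖ σ₀) (π₀ ∷ []) ∷ π₁ ∷ [])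

    attempt : ℕ → ℕ → ℕ
    attempt j n = ⟦ attemptᵖ ⟧ (j ∷ n ∷ [])

    attempt-code : ∀ ρ n → attempt (code ρ) n ≡ run (code ρ) (code (σ₀ ++ ρ)) Φ (n ∷ [])
    attempt-code ρ n rewrite ⟦appendCodeᵖ⟧ σ₀ ρ = ⟦compile⟧ Φ (code ρ) (code (σ₀ ++ ρ)) (n ∷ [])

    attempt-succeeds : ∀ n → ∃ λ j → attempt j n ≢ 0
    attempt-succeeds n with run-complete (Φ^A≡B n)
    ... | t , m , Φ≡ = code ρ , λ a≡0 → 1+n≢0 (trans (sym attempt≡) a≡0)
      where
      ρ = restrict (λ i → A (m₀ + i)) (m + t)
      t≤j : t ≤ code ρ
      t≤j = ≤-trans (m≤n+m t m) (≤-trans (≤-reflexive (sym (length-restrict _ (m + t)))) (length≤code ρ))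
      attempt≡ : attempt (code ρ) n ≡ suc (bit (B n))
      attempt≡ = begin
        attempt (code ρ) n
          ≡⟨ attempt-code ρ n ⟩
        run (code ρ) (code (σ₀ ++ ρ)) Φ (n ∷ [])
          ≡⟨ cong (λ σ → run (code ρ) (code σ) Φ (n ∷ [])) (restrict-+ A m₀ (m + t)) ⟨
        run (code ρ) (prefixCode A (m₀ + (m + t))) Φ (n ∷ [])
          ≡⟨ run-prefix-mono A Φ (n ∷ []) t≤j (≤-trans (m≤m+n m t) (m≤n+m _ m₀)) Φ≡ ⟩
        suc (bit (B n))
          ∎
        where open ≡-Reasoning

    attempt-agrees : ∀ n j {y z} → attempt j n ≡ suc y → Eval ∅ φ (n ∷ []) z → y ≡ z
    attempt-agrees n j {y} {z} attempt≡ φ↓ with y ≟ z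
    ... | yes y≡z = y≡z
    ... | no  y≢z with code-surjective j | run-complete φ↓
    ...   | ρ , refl | t , m , φ≡ = ⊥-elim (noExtension (ρ ++ ρ′) (subst (InCE W) (++-assoc σ₀ ρ ρ′) τ∈W))
      where
      K  = (code ρ ⊔ t) ⊔ (m ⊔ suc n)
      ρ′ = replicate K false
      τ  = (σ₀ ++ ρ) ++ ρ′
      K≤s : K ≤ code τ
      K≤s = subst (_≤ code τ) (length-replicate K) (length≤code-++ (σ₀ ++ ρ) ρ′)
      j≤s : code ρ ≤ code τ
      j≤s = ≤-trans (≤-trans (m≤m⊔n (code ρ) t) (m≤m⊔n (code ρ ⊔ t) (m ⊔ suc n))) K≤s
      t≤s : t ≤ code τ
      t≤s = ≤-trans (≤-trans (m≤n⊔m (code ρ) t) (m≤m⊔n (code ρ ⊔ t) (m ⊔ suc n))) K≤s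
      m≤s : m ≤ code τ
      m≤s = ≤-trans (≤-trans (m≤m⊔n m (suc n)) (m≤n⊔m (code ρ ⊔ t) (m ⊔ suc n))) K≤s
      n<s : n < code τ
      n<s = ≤-trans (≤-trans (m≤n⊔m m (suc n)) (m≤n⊔m (code ρ ⊔ t) (m ⊔ suc n))) K≤s
      Φ≡′ : Φ-run (code τ) n ≡ suc y
      Φ≡′ = run-mono Φ (n ∷ []) (code-⊑-++ (σ₀ ++ ρ) ρ′) j≤s (trans (sym (attempt-code ρ n)) attempt≡)
      φ≡′ : φ-run (code τ) n ≡ suc z
      φ≡′ = run-prefix-mono ∅ φ (n ∷ []) t≤s m≤s φ≡
      τ∈W : Dom W (code τ)
      τ∈W = W-dom⇐ (code τ) n n<s (disagree-intro (code τ) n Φ≡′ φ≡′ y≢z)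

    firstSuccess : ∀ n → ∃ (LeastNonzero (λ j → attempt j n))
    firstSuccess n = let (j , a≢0) = attempt-succeeds n in leastNonzero (λ j → attempt j n) j a≢0

    C : SetN
    C n = nonzero? (pred (attempt (proj₁ (firstSuccess n)) n))

    C-computable : Computable C
    C-computable = comp (toPR outᵖ) (minimise attemptᵖ ∷ proj fzero ∷ []) , λ n →
      let (j , least) = firstSuccess n in
      subst (Conv ∅ _ n) (trans (⟦outᵖ⟧ j n) (sym (bit∘nonzero? (pred (attempt j n)))))
        (ev-comp (evv-cons (Eval-minimise attemptᵖ n j least) (evv-cons ev-proj evv-nil)) (Eval-toPR outᵖ _))
      where
      outᵖ : Prim 2
      outᵖ = if0ᵖ (decᵖ attemptᵖ) zeroᵖ (constᵖ 1)
      ⟦outᵖ⟧ : ∀ j n → ⟦ outᵖ ⟧ (j ∷ n ∷ []) ≡ if0 (pred (attempt j n)) 0 1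
      ⟦outᵖ⟧ j n = trans (⟦if0ᵖ⟧ (decᵖ attemptᵖ) zeroᵖ (constᵖ 1) (j ∷ n ∷ []))
                         (cong (λ a → if0 a 0 1) (⟦decᵖ⟧ attemptᵖ (j ∷ n ∷ [])))

    C-agrees : ∀ n → Dom φ n → B n ≡ C n
    C-agrees n (z , φ↓) with firstSuccess n
    ... | j , a≢0 , _ with attempt j n in a≡
    ...   | zero  = ⊥-elim (a≢0 refl)
    ...   | suc y rewrite attempt-agrees n j a≡ φ↓ | φ-correct n z φ↓ = sym (nonzero?∘bit (B n))

corollary5p2 : (A B : SetN) → OneGeneric A → TuringBelow B A →
    GenericallyComputable B → CoarselyComputable B
corollary5p2 A B generic (Φ , Φ^A≡B) (φ , φ-correct , dense)
  with generic (Reduction.W A B Φ φ Φ^A≡B φ-correct)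
... | inj₁ (m , A↾m∈W) = ⊥-elim (Reduction.prefix∉W A B Φ φ Φ^A≡B φ-correct m A↾m∈W)
... | inj₂ (m , noExtension) = C , C-computable , DensityOne-mono C-agrees dense
  where open Reduction.Extending A B Φ φ Φ^A≡B φ-correct m noExtension
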